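{- For positive integers $m\le n$, the complete bipartite graph $K_{m,n}$ satisfies $IDI(K_{m,n})=n$ if $m<n$, and $IDI(K_{m,n})=n+1$ if $m=n$.
   Context: For a connected graph $G=(V,E)$ of diameter $d$ and $f:V\to\mathbb{R}$, the string of $v$ under $f$ is the $d$-vector whose $i$-th coordinate is $\sum_{w:\ d(v,w)=i} f(w)$ ($d(\cdot,\cdot)$ = graph distance). $IDI(G)$ is the minimum $k$ such that some $f$ with $|f(V)|=k$ gives all vertices pairwise distinct strings.
   Formalization: The functions f in the definition of $IDI(G)$ take values in ℚ rather than ℝ. -}

module Defs where

open import Data.Nat as ℕ using (ℕ; zero; suc; _⊔_; _<ᵇ_; _≤_; _<_)
open import Data.Bool using (Bool; true; false; not; _∧_; _∨_; if_then_else_)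
open import Data.Bool.Properties using () renaming (_≟_ to _≟ᵇ_)
open import Data.Fin using (Fin; toℕ)
open import Data.List using (List; []; _∷_; map; foldr; filter; length; deduplicate)
open import Data.Bool.ListAction using (any)
open import Data.List.Base using (allFin)
open import Data.Vec using (Vec; tabulate)
open import Data.Rational as ℚ using (ℚ; 0ℚ)
open import Data.Product using (Σ; _×_; _,_)
open import Relation.Binary.PropositionalEquality using (_≡_)
open import Relation.Nullary.Decidable using (does)

record Graph (N : ℕ) : Set where
  field
    adj   : Fin N → Fin N → Bool
    sym   : ∀ u v → adj u v ≡ adj v u
    irrfl : ∀ v → adj v v ≡ false
open Graph public

module _ {N : ℕ} (G : Graph N) where

  reach : ℕ → Fin N → Fin N → Bool
  reach zero    v w = does (v Data.Fin.≟ w)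
  reach (suc k) v w = reach k v w ∨ any (λ u → adj G v u ∧ reach k u w) (allFin N)

  private
    search : ℕ → ℕ → Fin N → Fin N → ℕ
    search zero      start v w = start
    search (suc fuel) start v w =
      if reach start v w then start else search fuel (suc start) v w

  -- Graph distance d(v,w): the length of a shortest walk from v to w.
  -- (In a connected graph on N vertices this is < N, so the search up to N
  -- finds it; for disconnected pairs the value N is returned, which never
  -- matters here since all graphs considered are connected.)
  dist : Fin N → Fin N → ℕ
  dist v w = search N 0 v w

  diameter : ℕ
  diameter = foldr _⊔_ 0 (map (λ v → foldr _⊔_ 0 (map (dist v) (allFin N))) (allFin N))

  string : (Fin N → ℚ) → Fin N → Vec ℚ diameter
  string f v = tabulate λ i →
    foldr ℚ._+_ 0ℚ (map f (filter (λ w → dist v w ℕ.≟ suc (toℕ i)) (allFin N)))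

  imageSize : (Fin N → ℚ) → ℕ
  imageSize f = length (deduplicate ℚ._≟_ (map f (allFin N)))

  Distinguishing : (Fin N → ℚ) → Set
  Distinguishing f = ∀ v w → string f v ≡ string f w → v ≡ w

  IsIDI : ℕ → Set
  IsIDI k = Σ (Fin N → ℚ) (λ f → Distinguishing f × imageSize f ≡ k)
          × (∀ f → Distinguishing f → k ≤ imageSize f)

side : (m : ℕ) {N : ℕ} → Fin N → Bool
side m v = toℕ v <ᵇ m

K : (m n : ℕ) → Graph (m ℕ.+ n)
K m n = record
  { adj   = λ u v → not (does (side m u ≟ᵇ side m v))
  ; sym   = λ u v → symAdj (side m u) (side m v)
  ; irrfl = λ v → irr (side m v)
  }
  where
  symAdj : ∀ a b → not (does (a ≟ᵇ b)) ≡ not (does (b ≟ᵇ a))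
  symAdj false false = Relation.Binary.PropositionalEquality.refl
  symAdj false true  = Relation.Binary.PropositionalEquality.refl
  symAdj true  false = Relation.Binary.PropositionalEquality.refl
  symAdj true  true  = Relation.Binary.PropositionalEquality.refl
  irr : ∀ a → not (does (a ≟ᵇ a)) ≡ false
  irr false = Relation.Binary.PropositionalEquality.refl
  irr true  = Relation.Binary.PropositionalEquality.refl

-- In K_{m,n} with both sides nonempty every vertex is within distance 2 of every other, so the
-- string of v has only two informative coordinates: the sum of f over the side opposite to v,
-- and the sum of f over v's own side minus f(v). Hence a distinguishing f must be injective on
-- each side, which already forces n values; conversely f is distinguishing as soon as it is
-- injective on each side and the two side sums differ. If m = n and f took only n values, each
-- side would take every value exactly once: the side sums would agree and some vertex of one
-- side would share its value with a vertex of the other side, and these two have equal strings.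
-- The bounds are attained by labelling one side 0, …, m - 1 and the other c, …, c + n - 1, with
-- c = 0 if m < n and c = 1 if m = n; the side sums are then distinct triangular numbers.
module Submission where

open import Defs
open import Data.Nat using (ℕ; suc; _≤_; _<_)
open import Data.Product using (_×_)
open import Relation.Binary.PropositionalEquality using (_≡_)

open import Algebra.Bundles using (CommutativeMonoid)
open import Data.Bool using (Bool; true; false; if_then_else_; _∧_; _∨_; not)
open import Data.Bool.ListAction using (any)
open import Data.Bool.Properties using () renaming (_≟_ to _≟ᵇ_)
import Data.Bool.Properties as Boolₚ
open import Data.Fin as Fin using (Fin; zero; suc; toℕ; fromℕ<; _↑ˡ_; _↑ʳ_; punchOut; splitAt; inject≤)
import Data.Fin.Properties as Finₚ
open import Data.Fin.Permutation using (permutation)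
open import Data.List using (List; []; _∷_; foldr; map; filter; tabulate; allFin; length; lookup; deduplicate)
open import Data.List.Membership.Propositional using (_∈_)
import Data.List.Membership.Propositional.Properties as ∈ₚ
import Data.List.Relation.Unary.All as All
open import Data.List.Relation.Unary.AllPairs using (_∷_)
open import Data.List.Relation.Unary.Any as Any using (here; there)
import Data.List.Relation.Unary.Any.Properties as Anyₚ
open import Data.List.Relation.Unary.Unique.Propositional using (Unique)
open import Data.Nat as ℕ using (zero; _+_; _⊔_; s≤s; _≤′_; ≤′-reflexive; ≤′-step)
import Data.Nat.Properties as ℕₚ
open import Data.Product using (∃; _,_; proj₁; proj₂)
open import Data.Rational as ℚ using (ℚ; 0ℚ; 1ℚ)
import Data.Rational.Properties as ℚₚ
open import Data.Sum using (_⊎_; [_,_]′)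
import Data.Vec as Vec
import Data.Vec.Properties as Vecₚ
open import Function using (_∘_; id; Injective)
open import Relation.Binary.Definitions using (DecidableEquality)
import Relation.Binary.PropositionalEquality as ≡
open ≡ using (refl; cong; cong₂; _≢_)
open import Relation.Nullary using (Dec; does; yes; no; contradiction)
open import Relation.Nullary.Decidable using (dec-true; dec-false)
open import Relation.Unary using (Pred)

import Algebra.Properties.Monoid.Sum ℕₚ.+-0-monoid as ℕΣ
open import Algebra.Properties.CommutativeSemigroup ℕₚ.+-commutativeSemigroup using (x∙yz≈y∙xz)

injective⇒surjective : ∀ {a k} (σ : Fin a → Fin k) → Injective _≡_ _≡_ σ → k ≤ a →
                       ∀ j → ∃ λ i → σ i ≡ j
injective⇒surjective {a} {suc k} σ σ-inj k≤a j with Finₚ.any? (λ i → σ i Fin.≟ j)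
... | yes hit  = hit
... | no  miss = contradiction (Finₚ.injective⇒≤ σ∖j-inj) (ℕₚ.<⇒≱ k≤a)
  where
  j≢σ : ∀ i → j ≢ σ i
  j≢σ i j≡σi = miss (i , ≡.sym j≡σi)
  σ∖j : Fin a → Fin k
  σ∖j i = punchOut (j≢σ i)
  σ∖j-inj : Injective _≡_ _≡_ σ∖j
  σ∖j-inj {x} {y} = σ-inj ∘ Finₚ.punchOut-injective (j≢σ x) (j≢σ y)

Unique⇒lookup-injective : ∀ {A : Set} {xs : List A} → Unique xs → Injective _≡_ _≡_ (lookup xs)
Unique⇒lookup-injective (_  ∷ _)   {zero}  {zero}  _ = refl
Unique⇒lookup-injective (x≢ ∷ _)   {zero}  {suc j} e = contradiction e (All.lookup x≢ (∈ₚ.∈-lookup j))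
Unique⇒lookup-injective (x≢ ∷ _)   {suc i} {zero}  e =
  contradiction (≡.sym e) (All.lookup x≢ (∈ₚ.∈-lookup i))
Unique⇒lookup-injective (_  ∷ xs!) {suc i} {suc j} e = cong suc (Unique⇒lookup-injective xs! e)

≤-foldr-⊔ : ∀ {x xs} → x ∈ xs → x ≤ foldr _⊔_ 0 xs
≤-foldr-⊔ {x} {_ ∷ ys} (here refl)  = ℕₚ.m≤m⊔n x (foldr _⊔_ 0 ys)
≤-foldr-⊔ {x} {y ∷ _}  (there x∈xs) = ℕₚ.m≤n⇒m≤o⊔n y (≤-foldr-⊔ x∈xs)

if-true : ∀ {A : Set} {b} {x y : A} → b ≡ true → (if b then x else y) ≡ x
if-true refl = refl

if-false : ∀ {A : Set} {b} {x y : A} → b ≡ false → (if b then x else y) ≡ y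
if-false refl = refl

∘not-≡ : ∀ {A : Set} (g : Bool → A) x y → g x ≡ g y → g (not x) ≡ g (not y)
∘not-≡ g true  true  _   = refl
∘not-≡ g false false _   = refl
∘not-≡ g true  false gxy = ≡.sym gxy
∘not-≡ g false true  gxy = ≡.sym gxy

any-≡-true : ∀ {A : Set} (p : A → Bool) {x xs} → x ∈ xs → p x ≡ true → any p xs ≡ true
any-≡-true p {xs = _ ∷ ys} (here refl)  px = cong (_∨ any p ys) px
any-≡-true p {xs = y ∷ _}  (there x∈xs) px =
  ≡.trans (cong (p y ∨_) (any-≡-true p x∈xs px)) (Boolₚ.∨-zeroʳ (p y))

any-≡-false : ∀ {A : Set} (p : A → Bool) xs → (∀ x → p x ≡ false) → any p xs ≡ false
any-≡-false p []       _       = refl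
any-≡-false p (x ∷ xs) p≡false = cong₂ _∨_ (p≡false x) (any-≡-false p xs p≡false)

any-∧-≟ : ∀ {N} (g : Fin N → Bool) w → any (λ u → g u ∧ does (u Fin.≟ w)) (allFin N) ≡ g w
any-∧-≟ {N} g w with g w in gw
... | true  = any-≡-true _ (∈ₚ.∈-allFin w) (cong₂ _∧_ gw (dec-true (w Fin.≟ w) refl))
... | false = any-≡-false _ (allFin N) term≡false
  where
  term≡false : ∀ u → g u ∧ does (u Fin.≟ w) ≡ false
  term≡false u with u Fin.≟ w
  ... | yes refl = ≡.trans (Boolₚ.∧-identityʳ (g u)) gw
  ... | no  _    = Boolₚ.∧-zeroʳ (g u)

-- Sums over finite sets

module Sums {c ℓ} (M : CommutativeMonoid c ℓ) where

  open CommutativeMonoid M renaming (refl to ≈-refl; sym to ≈-sym; trans to ≈-trans)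
  open import Algebra.Properties.CommutativeMonoid.Sum M
  open import Algebra.Properties.Monoid.Mult monoid using (×-homo-+) renaming (_×_ to _·_)

  ∑-↑ˡ-↑ʳ : ∀ a b (t : Fin (a + b) → Carrier) →
            sum t ≈ sum (λ i → t (i ↑ˡ b)) ∙ sum (λ j → t (a ↑ʳ j))
  ∑-↑ˡ-↑ʳ zero    b t = ≈-sym (identityˡ _)
  ∑-↑ˡ-↑ʳ (suc a) b t = ≈-trans (∙-congˡ (∑-↑ˡ-↑ʳ a b (t ∘ suc))) (≈-sym (assoc _ _ _))

  ∑-filter : ∀ {k} {A : Set} {p} {P : Pred A p} (P? : ∀ x → Dec (P x)) (f : A → Carrier)
             (g : Fin k → A) → foldr _∙_ ε (map f (filter P? (tabulate g)))
                               ≈ sum (λ i → if does (P? (g i)) then f (g i) else ε)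
  ∑-filter {zero}  P? f g = ≈-refl
  ∑-filter {suc k} P? f g with does (P? (g zero))
  ... | true  = ∙-congˡ (∑-filter P? f (g ∘ suc))
  ... | false = ≈-trans (∑-filter P? f (g ∘ suc)) (≈-sym (identityˡ _))

  ∑-except : ∀ {k} (t : Fin k → Carrier) i →
             sum (λ j → if does (i Fin.≟ j) then ε else t j) ∙ t i ≈ sum t
  ∑-except t zero    = ≈-trans (∙-congʳ (identityˡ _)) (comm _ _)
  ∑-except t (suc i) = ≈-trans (assoc _ _ _) (∙-congˡ (∑-except (t ∘ suc) i))

  ∑-reindex-injective : ∀ {a k} (t : Fin k → Carrier) (σ : Fin a → Fin k) →
                        Injective _≡_ _≡_ σ → k ≤ a → sum t ≈ sum (t ∘ σ)
  ∑-reindex-injective {a} {k} t σ σ-inj k≤a =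
    ∑-permute t (permutation σ σ⁻¹ (proj₂ ∘ surj) (λ i → σ-inj (proj₂ (surj (σ i)))))
    where
    surj : ∀ j → ∃ λ i → σ i ≡ j
    surj = injective⇒surjective σ σ-inj k≤a
    σ⁻¹ : Fin k → Fin a
    σ⁻¹ = proj₁ ∘ surj

  ∑-× : ∀ {k} (g : Fin k → ℕ) x → sum (λ i → g i · x) ≈ ℕΣ.sum g · x
  ∑-× {zero}  g x = ≈-refl
  ∑-× {suc k} g x = ≈-trans (∙-congˡ (∑-× (g ∘ suc) x)) (≈-sym (×-homo-+ x (g zero) _))

open Sums ℚₚ.+-0-commutativeMonoid
open import Algebra.Properties.CommutativeMonoid.Sum ℚₚ.+-0-commutativeMonoid
  using (sum; sum-syntax; sum-cong-≗; sum-replicate-zero)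
open import Algebra.Properties.Group ℚₚ.+-0-group using (∙-cancelˡ; ∙-cancelʳ)
open import Algebra.Properties.Monoid.Mult ℚₚ.+-0-monoid using () renaming (_×_ to _·_)

∑-suc : ∀ {k} (g : Fin k → ℕ) → ℕΣ.sum (suc ∘ g) ≡ k + ℕΣ.sum g
∑-suc {zero}  g = refl
∑-suc {suc k} g = cong suc (≡.trans (cong (g zero +_) (∑-suc (g ∘ suc))) (x∙yz≈y∙xz (g zero) k _))

triangle : ℕ → ℕ
triangle k = ℕΣ.sum {k} toℕ

triangle-suc : ∀ k → triangle (suc k) ≡ k + triangle k
triangle-suc k = ∑-suc {k} toℕ

triangle-mono-≤′ : ∀ {m n} → m ≤′ n → triangle m ≤ triangle n
triangle-mono-≤′ (≤′-reflexive refl) = ℕₚ.≤-refl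
triangle-mono-≤′ {n = suc n} (≤′-step m≤′n) =
  ℕₚ.≤-trans (triangle-mono-≤′ m≤′n)
    (ℕₚ.≤-trans (ℕₚ.m≤n+m _ n) (ℕₚ.≤-reflexive (≡.sym (triangle-suc n))))

triangle-mono-< : ∀ {m n} → 1 ≤ m → m < n → triangle m < triangle n
triangle-mono-< {m} {suc n} 1≤m (s≤s m≤n) = begin-strict
  triangle m       ≤⟨ triangle-mono-≤′ (ℕₚ.≤⇒≤′ m≤n) ⟩
  triangle n       <⟨ ℕₚ.m<n+m (triangle n) (ℕₚ.≤-trans 1≤m m≤n) ⟩
  n + triangle n   ≡⟨ triangle-suc n ⟨
  triangle (suc n) ∎
  where open ℕₚ.≤-Reasoning

toℚ : ℕ → ℚ
toℚ k = k · 1ℚ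

toℚ-nonNegative : ∀ k → 0ℚ ℚ.≤ toℚ k
toℚ-nonNegative zero    = ℚₚ.≤-refl
toℚ-nonNegative (suc k) = ℚₚ.+-mono-≤ (ℚₚ.<⇒≤ (ℚₚ.positive⁻¹ 1ℚ)) (toℚ-nonNegative k)

toℚ-suc-positive : ∀ k → 0ℚ ℚ.< toℚ (suc k)
toℚ-suc-positive k = ℚₚ.+-mono-<-≤ (ℚₚ.positive⁻¹ 1ℚ) (toℚ-nonNegative k)

toℚ-injective : Injective _≡_ _≡_ toℚ
toℚ-injective {zero}  {zero}  _ = refl
toℚ-injective {zero}  {suc l} e = contradiction e (ℚₚ.<⇒≢ (toℚ-suc-positive l))
toℚ-injective {suc k} {zero}  e = contradiction (≡.sym e) (ℚₚ.<⇒≢ (toℚ-suc-positive k))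
toℚ-injective {suc k} {suc l} e = cong suc (toℚ-injective (∙-cancelˡ 1ℚ _ _ e))

module Image {A : Set} (_≟_ : DecidableEquality A) {N : ℕ} (f : Fin N → A) where

  open import Data.List.Relation.Unary.Unique.DecPropositional.Properties _≟_ using (deduplicate-!)

  image : List A
  image = deduplicate _≟_ (map f (allFin N))

  ∈-image : ∀ v → f v ∈ image
  ∈-image v = ∈ₚ.∈-deduplicate⁺ _≟_ (∈ₚ.∈-map⁺ f (∈ₚ.∈-allFin v))

  positionInImage : Fin N → Fin (length image)
  positionInImage v = Any.index (∈-image v)

  lookup-positionInImage : ∀ v → lookup image (positionInImage v) ≡ f v
  lookup-positionInImage v = ≡.sym (Anyₚ.lookup-index (∈-image v))

  positionInImage-≡ : ∀ {v w} → positionInImage v ≡ positionInImage w → f v ≡ f w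
  positionInImage-≡ {v} {w} p≡ = ≡.trans (≡.sym (lookup-positionInImage v))
                                   (≡.trans (cong (lookup image) p≡) (lookup-positionInImage w))

  ≤-length-image : ∀ {a} (e : Fin a → Fin N) → Injective _≡_ _≡_ (f ∘ e) → a ≤ length image
  ≤-length-image e f∘e-inj = Finₚ.injective⇒≤ (f∘e-inj ∘ positionInImage-≡)

  length-image-≤ : ∀ {k} (h : Fin N → Fin k) (g : Fin k → A) → (∀ v → f v ≡ g (h v)) →
                   length image ≤ k
  length-image-≤ h g f≡g∘h = Finₚ.injective⇒≤ {f = h ∘ preimage}
    (Unique⇒lookup-injective (deduplicate-! (map f (allFin N))) ∘ lookup≡)
    where
    preimageOf : ∀ t → ∃ λ v → v ∈ allFin N × lookup image t ≡ f v
    preimageOf t = ∈ₚ.∈-map⁻ f (∈ₚ.∈-deduplicate⁻ _≟_ (map f (allFin N)) (∈ₚ.∈-lookup t))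
    preimage : Fin (length image) → Fin N
    preimage = proj₁ ∘ preimageOf
    lookup≡g∘h : ∀ t → lookup image t ≡ g (h (preimage t))
    lookup≡g∘h t = ≡.trans (proj₂ (proj₂ (preimageOf t))) (f≡g∘h (preimage t))
    lookup≡ : ∀ {t t′} → h (preimage t) ≡ h (preimage t′) → lookup image t ≡ lookup image t′
    lookup≡ {t} {t′} h≡ = ≡.trans (lookup≡g∘h t) (≡.trans (cong g h≡) (≡.sym (lookup≡g∘h t′)))

-- Distances and strings in a graph

module _ {N : ℕ} (G : Graph N) where

  reach-1 : ∀ v w → reach G 1 v w ≡ does (v Fin.≟ w) ∨ adj G v w
  reach-1 v w = cong (does (v Fin.≟ w) ∨_) (any-∧-≟ (adj G v) w)

  reach-1-adj : ∀ {v w} → adj G v w ≡ true → reach G 1 v w ≡ true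
  reach-1-adj {v} {w} vw = ≡.trans (reach-1 v w) (≡.trans (cong (_ ∨_) vw) (Boolₚ.∨-zeroʳ _))

  reach-1-nonadj : ∀ {v w} → v ≢ w → adj G v w ≡ false → reach G 1 v w ≡ false
  reach-1-nonadj {v} {w} v≢w vw = ≡.trans (reach-1 v w) (cong₂ _∨_ (dec-false (v Fin.≟ w) v≢w) vw)

  reach-2-common : ∀ {v u w} → adj G v u ≡ true → adj G u w ≡ true → reach G 2 v w ≡ true
  reach-2-common {v} {u} {w} vu uw = ≡.trans (cong (reach G 1 v w ∨_) via-u) (Boolₚ.∨-zeroʳ _)
    where
    via-u : any (λ x → adj G v x ∧ reach G 1 x w) (allFin N) ≡ true
    via-u = any-≡-true _ (∈ₚ.∈-allFin u) (cong₂ _∧_ vu (reach-1-adj uw))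

  dist≤diameter : ∀ v w → dist G v w ≤ diameter G
  dist≤diameter v w = ℕₚ.≤-trans (≤-foldr-⊔ (∈ₚ.∈-map⁺ (dist G v) (∈ₚ.∈-allFin w)))
    (≤-foldr-⊔ (∈ₚ.∈-map⁺ (λ u → foldr _⊔_ 0 (map (dist G u) (allFin N))) (∈ₚ.∈-allFin v)))

-- dist searches the walk lengths 0, 1, 2, … in turn, with fuel N; splitting on N exposes the
-- first steps of that search.

dist-refl : ∀ {N} (G : Graph N) v → dist G v v ≡ 0
dist-refl {suc N} G v = if-true (dec-true (v Fin.≟ v) refl)

dist-adj : ∀ {N} (G : Graph N) {v w} → v ≢ w → adj G v w ≡ true → dist G v w ≡ 1
dist-adj {suc zero}    G {zero} {zero} v≢w _  = contradiction refl v≢w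
dist-adj {suc (suc N)} G {v}    {w}    v≢w vw =
  ≡.trans (if-false (dec-false (v Fin.≟ w) v≢w)) (if-true (reach-1-adj G vw))

dist-common-neighbour : ∀ {N} (G : Graph N) {v u w} → v ≢ w → adj G v w ≡ false →
                        adj G v u ≡ true → adj G u w ≡ true → dist G v w ≡ 2
dist-common-neighbour {suc zero}          G {zero} {_} {zero} v≢w _  _  _  = contradiction refl v≢w
dist-common-neighbour {suc (suc zero)}    G {v}    {_} {w}    v≢w vw _  _  =
  ≡.trans (if-false (dec-false (v Fin.≟ w) v≢w)) (if-false (reach-1-nonadj G v≢w vw))
dist-common-neighbour {suc (suc (suc N))} G {v}    {_} {w}    v≢w vw vu uw =
  ≡.trans (if-false (dec-false (v Fin.≟ w) v≢w))
    (≡.trans (if-false (reach-1-nonadj G v≢w vw)) (if-true (reach-2-common G vu uw)))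

module _ {N : ℕ} (G : Graph N) (f : Fin N → ℚ) where

  sphereTerm : Fin N → ℕ → Fin N → ℚ
  sphereTerm v d w = if does (dist G v w ℕ.≟ d) then f w else 0ℚ

  sphereSum : Fin N → ℕ → ℚ
  sphereSum v d = ∑[ w < N ] sphereTerm v d w

  sphereTerm-at : ∀ {v w k} d → dist G v w ≡ k →
                  sphereTerm v d w ≡ (if does (k ℕ.≟ d) then f w else 0ℚ)
  sphereTerm-at {w = w} d dist≡k = cong (λ k → if does (k ℕ.≟ d) then f w else 0ℚ) dist≡k

  lookup-string : ∀ v i → Vec.lookup (string G f v) i ≡ sphereSum v (suc (toℕ i))
  lookup-string v i =
    ≡.trans (Vecₚ.lookup∘tabulate _ i) (∑-filter (λ w → dist G v w ℕ.≟ suc (toℕ i)) f id)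

  string-≡⁺ : ∀ {v w} → (∀ d → sphereSum v (suc d) ≡ sphereSum w (suc d)) →
              string G f v ≡ string G f w
  string-≡⁺ sphere≡ = Vecₚ.tabulate-cong λ i →
    ≡.trans (∑-filter _ f id) (≡.trans (sphere≡ (toℕ i)) (≡.sym (∑-filter _ f id)))

  string-≡⁻ : ∀ {v w} → string G f v ≡ string G f w →
              ∀ d → suc d ≤ diameter G → sphereSum v (suc d) ≡ sphereSum w (suc d)
  string-≡⁻ {v} {w} string≡ d d<diam = begin
    sphereSum v (suc d)          ≡⟨ cong (sphereSum v ∘ suc) toℕi≡d ⟨
    sphereSum v (suc (toℕ i))    ≡⟨ lookup-string v i ⟨
    Vec.lookup (string G f v) i  ≡⟨ cong (λ s → Vec.lookup s i) string≡ ⟩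
    Vec.lookup (string G f w) i  ≡⟨ lookup-string w i ⟩
    sphereSum w (suc (toℕ i))    ≡⟨ cong (sphereSum w ∘ suc) toℕi≡d ⟩
    sphereSum w (suc d)          ∎
    where
    open ≡.≡-Reasoning
    i : Fin (diameter G)
    i = fromℕ< d<diam
    toℕi≡d : toℕ i ≡ d
    toℕi≡d = Finₚ.toℕ-fromℕ< d<diam

-- The complete bipartite graph

side-↑ˡ : ∀ {m} (i : Fin m) n → side m (i ↑ˡ n) ≡ true
side-↑ˡ zero    n = refl
side-↑ˡ (suc i) n = side-↑ˡ i n

side-↑ʳ : ∀ m {n} (j : Fin n) → side m (m ↑ʳ j) ≡ false
side-↑ʳ zero    j = refl
side-↑ʳ (suc m) j = side-↑ʳ m j

side-↑ˡ≢side-↑ʳ : ∀ {m n} (i : Fin m) (j : Fin n) → side m (i ↑ˡ n) ≢ side m (m ↑ʳ j)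
side-↑ˡ≢side-↑ʳ {m} {n} i j sides≡
  with ≡.trans (≡.sym (side-↑ˡ i n)) (≡.trans sides≡ (side-↑ʳ m j))
... | ()

data Part (m n : ℕ) : Fin (m + n) → Set where
  left  : (i : Fin m) → Part m n (i ↑ˡ n)
  right : (j : Fin n) → Part m n (m ↑ʳ j)

part : ∀ m n (v : Fin (m + n)) → Part m n v
part zero    n v       = right v
part (suc m) n zero    = left zero
part (suc m) n (suc v) with part m n v
... | left i  = left (suc i)
... | right j = right j

module _ {m n : ℕ} where

  adj-K-cross : ∀ {v w} → side m v ≢ side m w → adj (K m n) v w ≡ true
  adj-K-cross {v} {w} sides≢ = cong not (dec-false (side m v ≟ᵇ side m w) sides≢)

  adj-K-same : ∀ {v w} → side m v ≡ side m w → adj (K m n) v w ≡ false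
  adj-K-same {v} {w} sides≡ = cong not (dec-true (side m v ≟ᵇ side m w) sides≡)

  dist-K-cross : ∀ {v w} → side m v ≢ side m w → dist (K m n) v w ≡ 1
  dist-K-cross sides≢ = dist-adj (K m n) (λ { refl → sides≢ refl }) (adj-K-cross sides≢)

  sideSum : (Fin (m + n) → ℚ) → Bool → ℚ
  sideSum f true  = ∑[ i < m ] f (i ↑ˡ n)
  sideSum f false = ∑[ j < n ] f (m ↑ʳ j)

  sideSum-indicator : ∀ f b → ∑[ w < m + n ] (if does (side m w ≟ᵇ b) then f w else 0ℚ) ≡ sideSum f b
  sideSum-indicator f b = ≡.trans (∑-↑ˡ-↑ʳ m n _) (halves b)
    where
    on : Bool → Fin (m + n) → ℚ
    on b w = if does (side m w ≟ᵇ b) then f w else 0ℚ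
    on-↑ˡ : ∀ b i → on b (i ↑ˡ n) ≡ (if does (true ≟ᵇ b) then f (i ↑ˡ n) else 0ℚ)
    on-↑ˡ b i = cong (λ s → if does (s ≟ᵇ b) then f (i ↑ˡ n) else 0ℚ) (side-↑ˡ i n)
    on-↑ʳ : ∀ b j → on b (m ↑ʳ j) ≡ (if does (false ≟ᵇ b) then f (m ↑ʳ j) else 0ℚ)
    on-↑ʳ b j = cong (λ s → if does (s ≟ᵇ b) then f (m ↑ʳ j) else 0ℚ) (side-↑ʳ m j)
    halves : ∀ b → ∑[ i < m ] on b (i ↑ˡ n) ℚ.+ ∑[ j < n ] on b (m ↑ʳ j) ≡ sideSum f b
    halves true  = ≡.trans (cong₂ ℚ._+_ (sum-cong-≗ (on-↑ˡ true))
                                        (≡.trans (sum-cong-≗ (on-↑ʳ true)) (sum-replicate-zero n)))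
                           (ℚₚ.+-identityʳ _)
    halves false = ≡.trans (cong₂ ℚ._+_ (≡.trans (sum-cong-≗ (on-↑ˡ false)) (sum-replicate-zero m))
                                        (sum-cong-≗ (on-↑ʳ false)))
                           (ℚₚ.+-identityˡ _)

  module _ (i₀ : Fin m) (j₀ : Fin n) where

    private
      G : Graph (m + n)
      G = K m n

    opposite : Bool → Fin (m + n)
    opposite true  = m ↑ʳ j₀
    opposite false = i₀ ↑ˡ n

    side-opposite : ∀ b → side m (opposite b) ≡ not b
    side-opposite true  = side-↑ʳ m j₀
    side-opposite false = side-↑ˡ i₀ n

    dist-K-same : ∀ {v w} → v ≢ w → side m v ≡ side m w → dist G v w ≡ 2
    dist-K-same {v} {w} v≢w sides≡ =
      dist-common-neighbour G v≢w (adj-K-same sides≡) (adj-K-cross v≁u) (adj-K-cross u≁w)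
      where
      u : Fin (m + n)
      u = opposite (side m v)
      v≁u : side m v ≢ side m u
      v≁u e = Boolₚ.not-¬ refl (≡.trans e (side-opposite (side m v)))
      u≁w : side m u ≢ side m w
      u≁w e = Boolₚ.not-¬ (≡.sym sides≡) (≡.trans (≡.sym e) (side-opposite (side m v)))

    1≤diameter : 1 ≤ diameter G
    1≤diameter = ℕₚ.≤-trans (ℕₚ.≤-reflexive (≡.sym (dist-K-cross (side-↑ˡ≢side-↑ʳ i₀ j₀))))
                            (dist≤diameter G (i₀ ↑ˡ n) (m ↑ʳ j₀))

    module _ (f : Fin (m + n) → ℚ) where

      sphere-1 : ∀ v → sphereSum G f v 1 ≡ sideSum f (not (side m v))
      sphere-1 v = ≡.trans (sum-cong-≗ term) (sideSum-indicator f (not (side m v)))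
        where
        opposite? : ∀ w → Dec (side m w ≡ not (side m v))
        opposite? w = side m w ≟ᵇ not (side m v)
        term : ∀ w → sphereTerm G f v 1 w ≡ (if does (opposite? w) then f w else 0ℚ)
        term w with v Fin.≟ w
        ... | yes refl = ≡.trans (sphereTerm-at G f 1 (dist-refl G v))
                           (≡.sym (if-false (dec-false (opposite? w) (Boolₚ.not-¬ refl))))
        ... | no v≢w with side m v ≟ᵇ side m w
        ...   | yes sides≡ = ≡.trans (sphereTerm-at G f 1 (dist-K-same v≢w sides≡))
                               (≡.sym (if-false (dec-false (opposite? w) (Boolₚ.not-¬ (≡.sym sides≡)))))
        ...   | no sides≢  = ≡.trans (sphereTerm-at G f 1 (dist-K-cross sides≢))
                               (≡.sym (if-true (dec-true (opposite? w) (Boolₚ.¬-not (sides≢ ∘ ≡.sym)))))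

      sphere-2 : ∀ v → sphereSum G f v 2 ℚ.+ f v ≡ sideSum f (side m v)
      sphere-2 v = ≡.trans (cong₂ ℚ._+_ (sum-cong-≗ term) (≡.sym (if-true (dec-true (same? v) refl))))
                           (≡.trans (∑-except sameSide v) (sideSum-indicator f (side m v)))
        where
        same? : ∀ w → Dec (side m w ≡ side m v)
        same? w = side m w ≟ᵇ side m v
        sameSide : Fin (m + n) → ℚ
        sameSide w = if does (same? w) then f w else 0ℚ
        term : ∀ w → sphereTerm G f v 2 w ≡ (if does (v Fin.≟ w) then 0ℚ else sameSide w)
        term w with v Fin.≟ w
        ... | yes refl = sphereTerm-at G f 2 (dist-refl G v)
        ... | no v≢w with side m v ≟ᵇ side m w
        ...   | yes sides≡ = ≡.trans (sphereTerm-at G f 2 (dist-K-same v≢w sides≡))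
                               (≡.sym (if-true (dec-true (same? w) (≡.sym sides≡))))
        ...   | no sides≢  = ≡.trans (sphereTerm-at G f 2 (dist-K-cross sides≢))
                               (≡.sym (if-false (dec-false (same? w) (sides≢ ∘ ≡.sym))))

      sphere-≥3 : ∀ v d → sphereSum G f v (3 + d) ≡ 0ℚ
      sphere-≥3 v d = ≡.trans (sum-cong-≗ term) (sum-replicate-zero (m + n))
        where
        term : ∀ w → sphereTerm G f v (3 + d) w ≡ 0ℚ
        term w with v Fin.≟ w
        ... | yes refl = sphereTerm-at G f (3 + d) (dist-refl G v)
        ... | no v≢w with side m v ≟ᵇ side m w
        ...   | yes sides≡ = sphereTerm-at G f (3 + d) (dist-K-same v≢w sides≡)
        ...   | no sides≢  = sphereTerm-at G f (3 + d) (dist-K-cross sides≢)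

      string-≡ : ∀ {v w} → sideSum f (side m v) ≡ sideSum f (side m w) → f v ≡ f w →
                 string G f v ≡ string G f w
      string-≡ {v} {w} sideSums≡ fv≡fw = string-≡⁺ G f sphere≡
        where
        open ≡.≡-Reasoning
        sphere≡ : ∀ d → sphereSum G f v (suc d) ≡ sphereSum G f w (suc d)
        sphere≡ zero = begin
          sphereSum G f v 1           ≡⟨ sphere-1 v ⟩
          sideSum f (not (side m v))  ≡⟨ ∘not-≡ (sideSum f) (side m v) (side m w) sideSums≡ ⟩
          sideSum f (not (side m w))  ≡⟨ sphere-1 w ⟨
          sphereSum G f w 1           ∎
        sphere≡ (suc zero) = ∙-cancelʳ (f v) _ _ (begin
          sphereSum G f v 2 ℚ.+ f v   ≡⟨ sphere-2 v ⟩
          sideSum f (side m v)        ≡⟨ sideSums≡ ⟩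
          sideSum f (side m w)        ≡⟨ sphere-2 w ⟨
          sphereSum G f w 2 ℚ.+ f w   ≡⟨ cong (sphereSum G f w 2 ℚ.+_) fv≡fw ⟨
          sphereSum G f w 2 ℚ.+ f v   ∎)
        sphere≡ (suc (suc d)) = ≡.trans (sphere-≥3 v d) (≡.sym (sphere-≥3 w d))

      string-≡⇒sideSum-≡ : ∀ {v w} → string G f v ≡ string G f w →
                           sideSum f (side m v) ≡ sideSum f (side m w)
      string-≡⇒sideSum-≡ {v} {w} string≡ =
        ≡.subst₂ (λ x y → sideSum f x ≡ sideSum f y)
          (Boolₚ.not-involutive (side m v)) (Boolₚ.not-involutive (side m w))
          (∘not-≡ (sideSum f) (not (side m v)) (not (side m w)) opposite≡)
        where
        opposite≡ : sideSum f (not (side m v)) ≡ sideSum f (not (side m w))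
        opposite≡ = ≡.trans (≡.sym (sphere-1 v))
                      (≡.trans (string-≡⁻ G f string≡ 0 1≤diameter) (sphere-1 w))

      string-≡⇒value-≡ : ∀ {v w} → string G f v ≡ string G f w → side m v ≡ side m w → f v ≡ f w
      string-≡⇒value-≡ {v} {w} string≡ sides≡ with v Fin.≟ w
      ... | yes refl = refl
      ... | no v≢w   = ∙-cancelˡ (sphereSum G f v 2) _ _ (begin
          sphereSum G f v 2 ℚ.+ f v   ≡⟨ sphere-2 v ⟩
          sideSum f (side m v)        ≡⟨ cong (sideSum f) sides≡ ⟩
          sideSum f (side m w)        ≡⟨ sphere-2 w ⟨
          sphereSum G f w 2 ℚ.+ f w   ≡⟨ cong (ℚ._+ f w) sphere2≡ ⟨
          sphereSum G f v 2 ℚ.+ f w   ∎)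
        where
        open ≡.≡-Reasoning
        sphere2≡ : sphereSum G f v 2 ≡ sphereSum G f w 2
        sphere2≡ = string-≡⁻ G f string≡ 1
                     (≡.subst (_≤ diameter G) (dist-K-same v≢w sides≡) (dist≤diameter G v w))

      distinguishing⇒↑ˡ-injective : Distinguishing G f → Injective _≡_ _≡_ (f ∘ (_↑ˡ n))
      distinguishing⇒↑ˡ-injective D {i} {i′} fi≡fi′ =
        Finₚ.↑ˡ-injective n i i′ (D _ _ (string-≡ sideSums≡ fi≡fi′))
        where
        sideSums≡ : sideSum f (side m (i ↑ˡ n)) ≡ sideSum f (side m (i′ ↑ˡ n))
        sideSums≡ = cong (sideSum f) (≡.trans (side-↑ˡ i n) (≡.sym (side-↑ˡ i′ n)))

      distinguishing⇒↑ʳ-injective : Distinguishing G f → Injective _≡_ _≡_ (f ∘ (m ↑ʳ_))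
      distinguishing⇒↑ʳ-injective D {j} {j′} fj≡fj′ =
        Finₚ.↑ʳ-injective m j j′ (D _ _ (string-≡ sideSums≡ fj≡fj′))
        where
        sideSums≡ : sideSum f (side m (m ↑ʳ j)) ≡ sideSum f (side m (m ↑ʳ j′))
        sideSums≡ = cong (sideSum f) (≡.trans (side-↑ʳ m j) (≡.sym (side-↑ʳ m j′)))

      distinguishing-criterion : Injective _≡_ _≡_ (f ∘ (_↑ˡ n)) → Injective _≡_ _≡_ (f ∘ (m ↑ʳ_)) →
                                 sideSum f true ≢ sideSum f false → Distinguishing G f
      distinguishing-criterion injˡ injʳ unbalanced v w string≡ with part m n v | part m n w
      ... | left i  | left i′  =
        cong (_↑ˡ n) (injˡ (string-≡⇒value-≡ string≡ (≡.trans (side-↑ˡ i n) (≡.sym (side-↑ˡ i′ n)))))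
      ... | right j | right j′ =
        cong (m ↑ʳ_) (injʳ (string-≡⇒value-≡ string≡ (≡.trans (side-↑ʳ m j) (≡.sym (side-↑ʳ m j′)))))
      ... | left i  | right j  =
        contradiction (≡.subst₂ (λ x y → sideSum f x ≡ sideSum f y) (side-↑ˡ i n) (side-↑ʳ m j)
                                (string-≡⇒sideSum-≡ string≡)) unbalanced
      ... | right j | left i   =
        contradiction (≡.subst₂ (λ x y → sideSum f x ≡ sideSum f y) (side-↑ˡ i n) (side-↑ʳ m j)
                                (≡.sym (string-≡⇒sideSum-≡ string≡))) unbalanced

distinguishing⇒n≤imageSize : ∀ {m n} → Fin m → Fin n → ∀ f → Distinguishing (K m n) f →
                             n ≤ imageSize (K m n) f
distinguishing⇒n≤imageSize {m} i₀ j₀ f D =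
  Image.≤-length-image ℚ._≟_ f (m ↑ʳ_) (distinguishing⇒↑ʳ-injective i₀ j₀ f D)

distinguishing⇒n<imageSize : ∀ {n} → Fin n → ∀ f → Distinguishing (K n n) f →
                             n < imageSize (K n n) f
distinguishing⇒n<imageSize {n} i₀ f D = ℕₚ.≰⇒> λ few →
  side-↑ˡ≢side-↑ʳ i₀ (partner few) (cong (side n) (D _ _ (strings≡ few)))
  where
  open Image ℚ._≟_ f

  injˡ : Injective _≡_ _≡_ (f ∘ (_↑ˡ n))
  injˡ = distinguishing⇒↑ˡ-injective i₀ i₀ f D
  injʳ : Injective _≡_ _≡_ (f ∘ (n ↑ʳ_))
  injʳ = distinguishing⇒↑ʳ-injective i₀ i₀ f D

  module _ (few : length image ≤ n) where

    ∑≡∑image : ∀ e → Injective _≡_ _≡_ (f ∘ e) →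
               ∑[ i < n ] f (e i) ≡ ∑[ t < length image ] lookup image t
    ∑≡∑image e f∘e-inj = ≡.trans (sum-cong-≗ (≡.sym ∘ lookup-positionInImage ∘ e))
      (≡.sym (∑-reindex-injective (lookup image) (positionInImage ∘ e)
                                  (f∘e-inj ∘ positionInImage-≡) few))

    partnerOf : ∃ λ j → positionInImage (n ↑ʳ j) ≡ positionInImage (i₀ ↑ˡ n)
    partnerOf = injective⇒surjective (positionInImage ∘ (n ↑ʳ_)) (injʳ ∘ positionInImage-≡) few _

    partner : Fin n
    partner = proj₁ partnerOf

    strings≡ : string (K n n) f (i₀ ↑ˡ n) ≡ string (K n n) f (n ↑ʳ partner)
    strings≡ = string-≡ i₀ i₀ f sideSums≡ (positionInImage-≡ (≡.sym (proj₂ partnerOf)))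
      where
      sideSums≡ : sideSum {n} f (side n (i₀ ↑ˡ n)) ≡ sideSum {n} f (side n (n ↑ʳ partner))
      sideSums≡ = ≡.subst₂ (λ x y → sideSum {n} {n} f x ≡ sideSum {n} {n} f y)
                    (≡.sym (side-↑ˡ i₀ n)) (≡.sym (side-↑ʳ n partner))
                    (≡.trans (∑≡∑image (_↑ˡ n) injˡ) (≡.sym (∑≡∑image (n ↑ʳ_) injʳ)))

-- The labellings attaining the bounds

module _ {m n : ℕ} (c : ℕ) (m≤c+n : m ≤ c + n) where

  place : Fin m ⊎ Fin n → Fin (c + n)
  place = [ (λ i → inject≤ i m≤c+n) , c ↑ʳ_ ]′

  label : Fin (m + n) → Fin (c + n)
  label = place ∘ splitAt m

  labelling : Fin (m + n) → ℚ
  labelling = toℚ ∘ toℕ ∘ label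

  labelling-↑ˡ : ∀ i → labelling (i ↑ˡ n) ≡ toℚ (toℕ i)
  labelling-↑ˡ i = cong toℚ (≡.trans (cong (toℕ ∘ place) (Finₚ.splitAt-↑ˡ m i n))
                                     (Finₚ.toℕ-inject≤ i m≤c+n))

  labelling-↑ʳ : ∀ j → labelling (m ↑ʳ j) ≡ toℚ (c + toℕ j)
  labelling-↑ʳ j = cong toℚ (≡.trans (cong (toℕ ∘ place) (Finₚ.splitAt-↑ʳ m n j)) (Finₚ.toℕ-↑ʳ c j))

  imageSize-labelling : imageSize (K m n) labelling ≤ c + n
  imageSize-labelling = Image.length-image-≤ ℚ._≟_ labelling label (toℚ ∘ toℕ) (λ _ → refl)

  labelling-distinguishing : Fin m → Fin n → triangle m ≢ ℕΣ.sum {n} (λ j → c + toℕ j) →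
                             Distinguishing (K m n) labelling
  labelling-distinguishing i₀ j₀ sums≢ =
    distinguishing-criterion i₀ j₀ labelling injˡ injʳ unbalanced
    where
    injˡ : Injective _≡_ _≡_ (labelling ∘ (_↑ˡ n))
    injˡ {i} {i′} e = Finₚ.toℕ-injective (toℚ-injective
      (≡.trans (≡.sym (labelling-↑ˡ i)) (≡.trans e (labelling-↑ˡ i′))))
    injʳ : Injective _≡_ _≡_ (labelling ∘ (m ↑ʳ_))
    injʳ {j} {j′} e = Finₚ.toℕ-injective (ℕₚ.+-cancelˡ-≡ c _ _ (toℚ-injective
      (≡.trans (≡.sym (labelling-↑ʳ j)) (≡.trans e (labelling-↑ʳ j′)))))
    unbalanced : sideSum {m} {n} labelling true ≢ sideSum {m} {n} labelling false
    unbalanced sums≡ = sums≢ (toℚ-injective (begin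
      toℚ (triangle m)                    ≡⟨ ∑-× {m} toℕ 1ℚ ⟨
      ∑[ i < m ] toℚ (toℕ i)              ≡⟨ sum-cong-≗ {m} labelling-↑ˡ ⟨
      sideSum {m} {n} labelling true      ≡⟨ sums≡ ⟩
      sideSum {m} {n} labelling false     ≡⟨ sum-cong-≗ {n} labelling-↑ʳ ⟩
      ∑[ j < n ] toℚ (c + toℕ j)          ≡⟨ ∑-× {n} (λ j → c + toℕ j) 1ℚ ⟩
      toℚ (ℕΣ.sum {n} (λ j → c + toℕ j))  ∎))
      where open ≡.≡-Reasoning

IDI-K-unbalanced : ∀ {m n} → 1 ≤ m → m < n → IsIDI (K m n) n
IDI-K-unbalanced {m} {n} 1≤m m<n =
  (labelling 0 m≤n , D , ℕₚ.≤-antisym (imageSize-labelling 0 m≤n) (lower-bound _ D)) , lower-bound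
  where
  m≤n : m ≤ n
  m≤n = ℕₚ.<⇒≤ m<n
  i₀ : Fin m
  i₀ = fromℕ< 1≤m
  j₀ : Fin n
  j₀ = fromℕ< (ℕₚ.≤-trans 1≤m m≤n)
  lower-bound : ∀ f → Distinguishing (K m n) f → n ≤ imageSize (K m n) f
  lower-bound = distinguishing⇒n≤imageSize i₀ j₀
  D : Distinguishing (K m n) (labelling 0 m≤n)
  D = labelling-distinguishing 0 m≤n i₀ j₀ (ℕₚ.<⇒≢ (triangle-mono-< 1≤m m<n))

IDI-K-balanced : ∀ {n} → 1 ≤ n → IsIDI (K n n) (suc n)
IDI-K-balanced {n} 1≤n =
  (labelling 1 n≤1+n , D , ℕₚ.≤-antisym (imageSize-labelling 1 n≤1+n) (lower-bound _ D)) , lower-bound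
  where
  n≤1+n : n ≤ 1 + n
  n≤1+n = ℕₚ.n≤1+n n
  i₀ : Fin n
  i₀ = fromℕ< 1≤n
  lower-bound : ∀ f → Distinguishing (K n n) f → suc n ≤ imageSize (K n n) f
  lower-bound = distinguishing⇒n<imageSize i₀
  D : Distinguishing (K n n) (labelling 1 n≤1+n)
  -- ℕΣ.sum (λ j → 1 + toℕ j) over Fin n is triangle (suc n) by definition.
  D = labelling-distinguishing 1 n≤1+n i₀ i₀ (ℕₚ.<⇒≢ (triangle-mono-< 1≤n (ℕₚ.n<1+n n)))

theorem7 : (m n : ℕ) → 1 ≤ m → m ≤ n →
    (m < n → IsIDI (K m n) n) × (m ≡ n → IsIDI (K m n) (suc n))
theorem7 m n 1≤m m≤n =
  IDI-K-unbalanced 1≤m , λ m≡n → ≡.subst (λ k → IsIDI (K m k) (suc k)) m≡n (IDI-K-balanced 1≤m)
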